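{- If $G$ is a block graph with $n$ vertices, then ${\rm mdim}(G)=n-\zeta(G)$.
   Context: All graphs are finite, simple and connected. A block of a graph is a maximal connected subgraph without cut vertices; $G$ is a block graph if every block of $G$ is a complete graph. $\zeta(G)$ denotes the number of cut vertices of $G$. For vertices $u,v$, $d_G(u,v)$ is the shortest-path distance; for an edge $x=ww'$ and a vertex $v$, $d_G(x,v)=\min\{d_G(w,v),d_G(w',v)\}$. A vertex $v$ resolves two elements $x,y\in V(G)\cup E(G)$ if $d_G(x,v)\ne d_G(y,v)$. A set $W\subseteq V(G)$ is a mixed resolving set of $G$ if every two distinct elements of $V(G)\cup E(G)$ are resolved by some vertex of $W$. The mixed metric dimension ${\rm mdim}(G)$ is the minimum cardinality of a mixed resolving set of $G$. -}

module Defs where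

open import Data.Nat using (ℕ; zero; suc; _≤_; _⊓_)
open import Data.Fin using (Fin)
open import Data.Fin.Subset using (Subset; _∈_; ∣_∣)
open import Data.Bool using (Bool; true; false)
open import Data.Product using (Σ; ∃; ∃-syntax; _×_; _,_)
open import Data.Sum using (_⊎_)
open import Data.Empty using (⊥)
open import Data.Unit using (⊤)
open import Relation.Nullary using (¬_)
open import Relation.Binary.PropositionalEquality using (_≡_; _≢_)
open import Function.Bundles using (_⇔_)

record Graph (n : ℕ) : Set where
  field
    adj    : Fin n → Fin n → Bool
    sym    : ∀ u v → adj u v ≡ adj v u
    irrefl : ∀ v → adj v v ≡ false
open Graph public

module _ {n : ℕ} (G : Graph n) where

  Adj : Fin n → Fin n → Set
  Adj u v = adj G u v ≡ true

  data WalkIn (S : Fin n → Set) : Fin n → Fin n → ℕ → Set where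
    here : ∀ {a} → S a → WalkIn S a a zero
    step : ∀ {a b c k} → S a → Adj a b → WalkIn S b c k → WalkIn S a c (suc k)

  Walk : Fin n → Fin n → ℕ → Set
  Walk = WalkIn (λ _ → ⊤)

  ConnectedIn : (Fin n → Set) → Set
  ConnectedIn S = ∀ a b → S a → S b → ∃[ k ] WalkIn S a b k

  Connected : Set
  Connected = ConnectedIn (λ _ → ⊤)

  IsCutVertex : Fin n → Set
  IsCutVertex v = ¬ ConnectedIn (λ a → a ≢ v)

  NoCutVertexIn : (Fin n → Set) → Set
  NoCutVertexIn S = ∀ v → S v → ConnectedIn (λ a → S a × a ≢ v)

  -- A block: a maximal connected subgraph without cut vertices
  -- (maximal such subgraphs are necessarily induced, so we range over
  -- vertex sets and take induced subgraphs).
  IsBlock : (Fin n → Set) → Set₁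
  IsBlock S = (∃[ v ] S v) × ConnectedIn S × NoCutVertexIn S
            × (∀ (T : Fin n → Set) → (∀ a → S a → T a)
                 → ConnectedIn T → NoCutVertexIn T → ∀ a → T a → S a)

  IsBlockGraph : Set₁
  IsBlockGraph = ∀ S → IsBlock S → ∀ a b → S a → S b → a ≢ b → Adj a b

  IsDist : Fin n → Fin n → ℕ → Set
  IsDist a b k = Walk a b k × (∀ m → Walk a b m → k ≤ m)

  -- Elements of V(G) ∪ E(G); an edge is given by its two ends (in either order).
  data Elem : Set where
    vtx : Fin n → Elem
    edg : (a b : Fin n) → Adj a b → Elem

  SameElem : Elem → Elem → Set
  SameElem (vtx u) (vtx v) = u ≡ v
  SameElem (vtx _) (edg _ _ _) = ⊥
  SameElem (edg _ _ _) (vtx _) = ⊥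
  SameElem (edg a b _) (edg c d _) = (a ≡ c × b ≡ d) ⊎ (a ≡ d × b ≡ c)

  ElemDist : Elem → Fin n → ℕ → Set
  ElemDist (vtx u) w k = IsDist u w k
  ElemDist (edg a b _) w k = ∃[ i ] ∃[ j ] IsDist a w i × IsDist b w j × k ≡ i ⊓ j

  Resolves : Fin n → Elem → Elem → Set
  Resolves w x y = ∃[ i ] ∃[ j ] ElemDist x w i × ElemDist y w j × i ≢ j

  IsMixedResolving : Subset n → Set
  IsMixedResolving W = ∀ x y → ¬ SameElem x y → ∃[ w ] (w ∈ W × Resolves w x y)

  MixedMetricDimIs : ℕ → Set
  MixedMetricDimIs m = (∃[ W ] (IsMixedResolving W × ∣ W ∣ ≡ m))
                     × (∀ W → IsMixedResolving W → m ≤ ∣ W ∣)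

{-# OPTIONS --safe #-}
module Submission where

-- Upper bound, valid in every connected graph: the non-cut vertices resolve all elements.
-- Given elements x ≠ y and an end a of y that is not an end of x, climb from a to ever
-- farther vertices from x.  A cut vertex always has a neighbour farther from x (otherwise
-- every vertex descends to x avoiding it), so the climb ends at a non-cut vertex w, and
-- d(y, w) ≤ d(a, w) < d(x, w).
--
-- Lower bound: a non-cut vertex v of a block graph is simplicial, since the edge vx together
-- with a path from y to x avoiding v spans a two-connected set, contained in a block, which
-- is complete.  For a neighbour u of v, every w ≠ v is then at least as close to u as to v,
-- so only v itself resolves u and the edge uv; hence v lies in every mixed resolving set.

open import Defs hiding (sym)
open import Data.Nat using (ℕ; zero; suc; _≤_; _<_; _∸_; _+_; _⊓_; _⊔_; z≤n; s≤s; s≤s⁻¹; _<?_)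
open import Data.Nat.Properties
open import Data.Nat.Induction using (<-rec)
open import Data.Fin using (Fin; zero; suc; toℕ; fromℕ<) renaming (_≟_ to _≟ᶠ_)
open import Data.Fin.Properties using (any?; toℕ<n; toℕ-fromℕ<; punchInᵢ≢i)
open import Data.Fin.Subset using (Subset; _∈_; _∉_; _⊆_; _∪_; ⁅_⁆; ∣_∣; ∁)
open import Data.Fin.Subset.Properties
  using (_∈?_; p⊆p∪q; x∈p∪q⁺; x∈p∪q⁻; x∈⁅x⁆; x∈⁅y⁆⇒x≡y;
         p⊂q⇒∣p∣<∣q∣; p⊆q⇒∣p∣≤∣q∣; ∣p∣≤n;
         x∉p⇒x∈∁p; x∈∁p⇒x∉p; ∣∁p∣≡n∸∣p∣)
open import Data.Vec using (tabulate)
open import Data.Vec.Properties using (lookup∘tabulate; lookup⇒[]=; []=⇒lookup)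
open import Data.Bool using (true)
import Data.Bool.Properties as Bool
open import Data.Product using (Σ; ∃-syntax; _×_; _,_; proj₁; proj₂; map₁; map₂)
import Data.Sum as Sum
open import Data.Sum using (_⊎_; inj₁; inj₂)
open import Data.Empty using (⊥-elim)
open import Data.Unit using (⊤; tt)
open import Function using (_∘_; id)
open import Function.Bundles using (_⇔_; Equivalence)
open import Relation.Nullary using (Dec; yes; no; does; ¬_)
open import Relation.Nullary.Decidable using (_×-dec_; _⊎-dec_; ¬?; dec-true; decidable-stable)
open import Relation.Unary using (Decidable)
open import Relation.Binary.PropositionalEquality

minimal-witness : ∀ {P : ℕ → Set} → Decidable P → ∀ {k} → P k →
                  ∃[ m ] P m × (∀ {m′} → P m′ → m ≤ m′)
minimal-witness {P} P? = <-rec _ search _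
  where
  search : ∀ k → (∀ {j} → j < k → P j → ∃[ m ] P m × (∀ {m′} → P m′ → m ≤ m′))
         → P k → ∃[ m ] P m × (∀ {m′} → P m′ → m ≤ m′)
  search k smaller pk with any? (λ (i : Fin k) → P? (toℕ i))
  ... | yes (i , pi) = smaller (toℕ<n i) pi
  ... | no none = k , pk , λ {m} pm → ≮⇒≥ λ m<k →
                    none (fromℕ< m<k , subst P (sym (toℕ-fromℕ< m<k)) pm)

maximum : ∀ {n} → (Fin n → ℕ) → ℕ
maximum {zero} f = 0
maximum {suc n} f = f zero ⊔ maximum (λ i → f (suc i))

≤-maximum : ∀ {n} (f : Fin n → ℕ) i → f i ≤ maximum f
≤-maximum {suc n} f zero = m≤m⊔n _ _
≤-maximum {suc n} f (suc i) = ≤-trans (≤-maximum (λ j → f (suc j)) i) (m≤n⊔m _ _)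

⟦_⟧ : ∀ {n} {P : Fin n → Set} → Decidable P → Subset n
⟦ P? ⟧ = tabulate (λ c → does (P? c))

∈⟦⟧⁺ : ∀ {n} {P : Fin n → Set} (P? : Decidable P) {c} → P c → c ∈ ⟦ P? ⟧
∈⟦⟧⁺ P? {c} p = lookup⇒[]= c _ (trans (lookup∘tabulate _ c) (dec-true (P? c) p))

∈⟦⟧⁻ : ∀ {n} {P : Fin n → Set} (P? : Decidable P) {c} → c ∈ ⟦ P? ⟧ → P c
∈⟦⟧⁻ P? {c} c∈ with P? c | trans (sym (lookup∘tabulate (λ c → does (P? c)) c)) ([]=⇒lookup c∈)
... | yes p | _ = p
... | no _ | ()

module Walks {n : ℕ} (G : Graph n) where

  adj-sym : ∀ {a b} → Adj G a b → Adj G b a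
  adj-sym {a} {b} e = trans (sym (Graph.sym G a b)) e

  adj⇒≢ : ∀ {a b} → Adj G a b → a ≢ b
  adj⇒≢ {a} e refl with trans (sym e) (irrefl G a)
  ... | ()

  adj? : ∀ a b → Dec (Adj G a b)
  adj? a b = adj G a b Bool.≟ true

  mapʷ : ∀ {S S′ : Fin n → Set} {a b k} → (∀ {c} → S c → S′ c) → WalkIn G S a b k → WalkIn G S′ a b k
  mapʷ f (here s) = here (f s)
  mapʷ f (step s e w) = step (f s) e (mapʷ f w)

  module _ {S : Fin n → Set} where

    last-in : ∀ {a b k} → WalkIn G S a b k → S b
    last-in (here s) = s
    last-in (step _ _ w) = last-in w

    infixr 5 _++ʷ_
    _++ʷ_ : ∀ {a b c k l} → WalkIn G S a b k → WalkIn G S b c l → WalkIn G S a c (k + l)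
    here _ ++ʷ w′ = w′
    step s e w ++ʷ w′ = step s e (w ++ʷ w′)

    snoc : ∀ {a b c k} → WalkIn G S a b k → Adj G b c → S c → WalkIn G S a c (suc k)
    snoc (here s) e s′ = step s e (here s′)
    snoc (step s e w) e′ s′ = step s e (snoc w e′ s′)

    reverse : ∀ {a b k} → WalkIn G S a b k → WalkIn G S b a k
    reverse (here s) = here s
    reverse (step s e w) = snoc (reverse w) (adj-sym e) s

    On : ∀ {a b k} → WalkIn G S a b k → Fin n → Set
    On (here {a} _) c = c ≡ a
    On (step {a} _ _ w) c = c ≡ a ⊎ On w c

    on? : ∀ {a b k} (w : WalkIn G S a b k) c → Dec (On w c)
    on? (here {a} _) c = c ≟ᶠ a
    on? (step {a} _ _ w) c = (c ≟ᶠ a) ⊎-dec on? w c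

    on-head : ∀ {a b k} (w : WalkIn G S a b k) → On w a
    on-head (here _) = refl
    on-head (step _ _ _) = inj₁ refl

    on-last : ∀ {a b k} (w : WalkIn G S a b k) → On w b
    on-last (here _) = refl
    on-last (step _ _ w) = inj₂ (on-last w)

    on-inside : ∀ {a b k} (w : WalkIn G S a b k) → ∀ {c} → On w c → S c
    on-inside (here s) refl = s
    on-inside (step s _ _) (inj₁ refl) = s
    on-inside (step _ _ w) (inj₂ o) = on-inside w o

  restrict : ∀ {S S′ : Fin n → Set} {a b k} (w : WalkIn G S a b k) → (∀ {c} → On w c → S′ c)
           → WalkIn G S′ a b k
  restrict (here s) f = here (f refl)
  restrict (step s e w) f = step (f (inj₁ refl)) e (restrict w (λ o → f (inj₂ o)))

  module _ {S : Fin n → Set} where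

    suffix : ∀ {a b k c} (w : WalkIn G S a b k) → On w c → ∃[ k′ ] k′ ≤ k × WalkIn G (On w) c b k′
    suffix (here s) refl = 0 , z≤n , here refl
    suffix w@(step _ _ _) (inj₁ refl) = _ , ≤-refl , restrict w (λ o → o)
    suffix (step s e w) (inj₂ o) with suffix w o
    ... | k′ , k′≤k , w′ = k′ , m≤n⇒m≤1+n k′≤k , mapʷ inj₂ w′

    NoRepeat : ∀ {a b k} → WalkIn G S a b k → Set
    NoRepeat (here _) = ⊤
    NoRepeat (step {a} _ _ w) = ¬ On w a × NoRepeat w

    shortcut : ∀ {a b k} (w : WalkIn G S a b k) → NoRepeat w ⊎ ∃[ k′ ] k′ < k × WalkIn G S a b k′
    shortcut (here _) = inj₁ tt
    shortcut (step {a} s e w) with shortcut w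
    ... | inj₂ (k′ , k′<k , w′) = inj₂ (suc k′ , s≤s k′<k , step s e w′)
    ... | inj₁ nr with on? w a
    ... | no a∉w = inj₁ (a∉w , nr)
    ... | yes a∈w with suffix w a∈w
    ... | k′ , k′≤k , w′ = inj₂ (k′ , s≤s k′≤k , restrict w′ (λ o → on-inside w (on-inside w′ o)))

    to-path : ∀ {a b k} → WalkIn G S a b k → ∃[ k′ ] Σ (WalkIn G S a b k′) NoRepeat
    to-path {a} {b} {k} = <-rec (λ k → WalkIn G S a b k → ∃[ k′ ] Σ (WalkIn G S a b k′) NoRepeat) go k
      where
      go : ∀ k → (∀ {j} → j < k → WalkIn G S a b j → ∃[ k′ ] Σ (WalkIn G S a b k′) NoRepeat)
         → WalkIn G S a b k → ∃[ k′ ] Σ (WalkIn G S a b k′) NoRepeat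
      go k shorter w with shortcut w
      ... | inj₁ nr = k , w , nr
      ... | inj₂ (j , j<k , w′) = shorter j<k w′

    reach-an-end : ∀ {a b k} (w : WalkIn G S a b k) → NoRepeat w → ∀ {z c} → On w z → On w c → c ≢ z
                 → (∃[ m ] WalkIn G (λ v → On w v × v ≢ z) c b m)
                 ⊎ (∃[ m ] WalkIn G (λ v → On w v × v ≢ z) c a m)
    reach-an-end (here _) _ refl refl c≢z = ⊥-elim (c≢z refl)
    reach-an-end (step _ _ _) _ _ (inj₁ refl) c≢z = inj₂ (0 , here (inj₁ refl , c≢z))
    reach-an-end (step _ _ w) (a∉w , _) (inj₁ refl) (inj₂ c∈w) _ =
      let m , _ , w′ = suffix w c∈w
      in inj₁ (m , mapʷ (λ v∈w → inj₂ v∈w , λ { refl → a∉w v∈w }) w′)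
    reach-an-end (step _ e w) (a∉w , w-path) (inj₂ z∈w) (inj₂ c∈w) c≢z with reach-an-end w w-path z∈w c∈w c≢z
    ... | inj₁ (m , w′) = inj₁ (m , mapʷ (map₁ inj₂) w′)
    ... | inj₂ (m , w′) =
      inj₂ (suc m , snoc (mapʷ (map₁ inj₂) w′) (adj-sym e) (inj₁ refl , λ { refl → a∉w z∈w }))

  walk? : ∀ {S : Fin n → Set} → Decidable S → ∀ m a b → Dec (WalkIn G S a b m)
  walk? S? zero a b with a ≟ᶠ b | S? a
  ... | yes refl | yes s = yes (here s)
  ... | yes refl | no ¬s = no λ { (here s) → ¬s s }
  ... | no a≢b | _ = no λ { (here _) → a≢b refl }
  walk? S? (suc m) a b with S? a | any? (λ c → adj? a c ×-dec walk? S? m c b)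
  ... | no ¬s | _ = no λ { (step s _ _) → ¬s s }
  ... | yes s | yes (c , e , w) = yes (step s e w)
  ... | yes s | no ¬ex = no λ { (step _ e w) → ¬ex (_ , e , w) }

isDist-unique : ∀ {n} {G : Graph n} {a b i j} → IsDist G a b i → IsDist G a b j → i ≡ j
isDist-unique (wi , mi) (wj , mj) = ≤-antisym (mi _ wj) (mj _ wi)

module Distance {n : ℕ} (G : Graph n) (conn : Connected G) where
  open Walks G

  dist-spec : ∀ a b → ∃[ m ] IsDist G a b m
  dist-spec a b with minimal-witness (λ m → walk? (λ _ → yes tt) m a b) (proj₂ (conn a b tt tt))
  ... | m , w , minimal = m , w , λ _ w′ → minimal w′

  -- Opaque, so that unification never runs the shortest-walk search behind dist.
  opaque
    dist : Fin n → Fin n → ℕ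
    dist a b = proj₁ (dist-spec a b)

    dist-isDist : ∀ a b → IsDist G a b (dist a b)
    dist-isDist a b = proj₂ (dist-spec a b)

  dist-walk : ∀ a b → Walk G a b (dist a b)
  dist-walk a b = proj₁ (dist-isDist a b)

  dist-minimal : ∀ {a b m} → Walk G a b m → dist a b ≤ m
  dist-minimal {a} {b} w = proj₂ (dist-isDist a b) _ w

  dist-refl : ∀ a → dist a a ≡ 0
  dist-refl a = n≤0⇒n≡0 (dist-minimal (here tt))

  dist≡0⇒≡ : ∀ {a b} → dist a b ≡ 0 → a ≡ b
  dist≡0⇒≡ {a} {b} eq with subst (Walk G a b) eq (dist-walk a b)
  ... | here _ = refl

  dist-adjʳ : ∀ {a b c} → Adj G b c → dist a c ≤ suc (dist a b)
  dist-adjʳ {a} {b} e = dist-minimal (snoc (dist-walk a b) e tt)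

  dist-adjˡ : ∀ {a b c} → Adj G a b → dist a c ≤ suc (dist b c)
  dist-adjˡ {a} {b} {c} e = dist-minimal (step tt e (dist-walk b c))

  dist-pred : ∀ {a b k} → dist a b ≡ suc k → ∃[ c ] Adj G b c × dist a c ≤ k
  dist-pred {a} {b} eq with reverse (subst (Walk G a b) eq (dist-walk a b))
  ... | step _ e w = _ , e , dist-minimal (reverse w)

module Resolving {n : ℕ} (G : Graph n) (conn : Connected G) where
  open Walks G
  open Distance G conn

  end₁ end₂ : Elem G → Fin n
  end₁ (vtx u) = u
  end₁ (edg a _ _) = a
  end₂ (vtx u) = u
  end₂ (edg _ b _) = b

  IsEnd : Fin n → Elem G → Set
  IsEnd a x = a ≡ end₁ x ⊎ a ≡ end₂ x

  end? : ∀ a x → Dec (IsEnd a x)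
  end? a x = (a ≟ᶠ end₁ x) ⊎-dec (a ≟ᶠ end₂ x)

  ends-joined : ∀ x → end₁ x ≡ end₂ x ⊎ Adj G (end₁ x) (end₂ x)
  ends-joined (vtx u) = inj₁ refl
  ends-joined (edg a b e) = inj₂ e

  ends-determine : ∀ x y → (∀ {a} → IsEnd a x → IsEnd a y) → (∀ {a} → IsEnd a y → IsEnd a x)
                 → SameElem G x y
  ends-determine (vtx u) (vtx v) x⊆y _ with x⊆y (inj₁ refl)
  ... | inj₁ u≡v = u≡v
  ... | inj₂ u≡v = u≡v
  ends-determine x@(vtx _) y@(edg a b e) _ y⊆x =
    adj⇒≢ e (trans (single (y⊆x (inj₁ refl))) (sym (single (y⊆x (inj₂ refl)))))
    where
    single : ∀ {c} → IsEnd c x → c ≡ end₁ x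
    single (inj₁ c≡u) = c≡u
    single (inj₂ c≡u) = c≡u
  ends-determine x@(edg _ _ _) y@(vtx _) x⊆y y⊆x = ends-determine y x y⊆x x⊆y
  ends-determine (edg a b e) (edg c d _) x⊆y _ with x⊆y (inj₁ refl) | x⊆y (inj₂ refl)
  ... | inj₁ a≡c | inj₁ b≡c = ⊥-elim (adj⇒≢ e (trans a≡c (sym b≡c)))
  ... | inj₁ a≡c | inj₂ b≡d = inj₁ (a≡c , b≡d)
  ... | inj₂ a≡d | inj₁ b≡c = inj₂ (a≡d , b≡c)
  ... | inj₂ a≡d | inj₂ b≡d = ⊥-elim (adj⇒≢ e (trans a≡d (sym b≡d)))

  differing-end : ∀ x y → ¬ SameElem G x y
                → (∃[ a ] IsEnd a y × ¬ IsEnd a x) ⊎ (∃[ a ] IsEnd a x × ¬ IsEnd a y)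
  differing-end x y x≠y with any? (λ a → end? a y ×-dec ¬? (end? a x))
                           | any? (λ a → end? a x ×-dec ¬? (end? a y))
  ... | yes y∖x | _ = inj₁ y∖x
  ... | no _ | yes x∖y = inj₂ x∖y
  ... | no y⊆x | no x⊆y = ⊥-elim (x≠y (ends-determine x y (included x y x⊆y) (included y x y⊆x)))
    where
    included : ∀ z z′ → ¬ (∃[ a ] IsEnd a z × ¬ IsEnd a z′) → ∀ {a} → IsEnd a z → IsEnd a z′
    included z z′ none {a} a∈z = decidable-stable (end? a z′) λ a∉z′ → none (a , a∈z , a∉z′)

  elem-dist : Elem G → Fin n → ℕ
  elem-dist x w = dist (end₁ x) w ⊓ dist (end₂ x) w

  elem-dist-spec : ∀ x w → ElemDist G x w (elem-dist x w)
  elem-dist-spec (vtx u) w rewrite ⊓-idem (dist u w) = dist-isDist u w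
  elem-dist-spec (edg a b _) w = dist a w , dist b w , dist-isDist a w , dist-isDist b w , refl

  elem-dist≤end : ∀ {a} x w → IsEnd a x → elem-dist x w ≤ dist a w
  elem-dist≤end _ _ (inj₁ refl) = m⊓n≤m _ _
  elem-dist≤end _ _ (inj₂ refl) = m⊓n≤n _ _

  resolves-by-< : ∀ x y {w} → elem-dist y w < elem-dist x w → Resolves G w x y
  resolves-by-< x y {w} lt =
    elem-dist x w , elem-dist y w , elem-dist-spec x w , elem-dist-spec y w , λ eq → <⇒≢ lt (sym eq)

  resolves-sym : ∀ {w x y} → Resolves G w x y → Resolves G w y x
  resolves-sym (i , j , dx , dy , i≢j) = j , i , dy , dx , λ j≡i → i≢j (sym j≡i)

  module Climb (x : Elem G) where

    δ : Fin n → ℕ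
    δ = elem-dist x

    δ-adj : ∀ {u v} → Adj G u v → δ u ≤ suc (δ v)
    δ-adj e = ⊓-mono-≤ (dist-adjʳ (adj-sym e)) (dist-adjʳ (adj-sym e))

    nearer-neighbour : ∀ {u k} → δ u ≡ suc k → ∃[ v ] Adj G u v × δ v ≤ k
    nearer-neighbour {u} δu≡1+k with ⊓-sel (dist (end₁ x) u) (dist (end₂ x) u)
    ... | inj₁ δ≡d₁ = let v , e , le = dist-pred (trans (sym δ≡d₁) δu≡1+k) in v , e , ≤-trans (m⊓n≤m _ _) le
    ... | inj₂ δ≡d₂ = let v , e , le = dist-pred (trans (sym δ≡d₂) δu≡1+k) in v , e , ≤-trans (m⊓n≤n _ _) le

    δ-pred : ∀ {u k} → δ u ≡ suc k → ∃[ v ] Adj G u v × δ v ≡ k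
    δ-pred δu≡1+k =
      let v , e , δv≤k = nearer-neighbour δu≡1+k
      in v , e , ≤-antisym δv≤k (s≤s⁻¹ (subst (_≤ suc (δ v)) δu≡1+k (δ-adj e)))

    δ≡0⇒end : ∀ {u} → δ u ≡ 0 → IsEnd u x
    δ≡0⇒end {u} δu≡0 with ⊓-sel (dist (end₁ x) u) (dist (end₂ x) u)
    ... | inj₁ δ≡d₁ = inj₁ (sym (dist≡0⇒≡ (trans (sym δ≡d₁) δu≡0)))
    ... | inj₂ δ≡d₂ = inj₂ (sym (dist≡0⇒≡ (trans (sym δ≡d₂) δu≡0)))

    end⇒δ≡0 : ∀ {u} → IsEnd u x → δ u ≡ 0
    end⇒δ≡0 {u} u∈x = n≤0⇒n≡0 (subst (δ u ≤_) (dist-refl u) (elem-dist≤end x u u∈x))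

    ¬end⇒δ>0 : ∀ {u} → ¬ IsEnd u x → 0 < δ u
    ¬end⇒δ>0 u∉x = n≢0⇒n>0 λ δu≡0 → u∉x (δ≡0⇒end δu≡0)

    peak-not-cut : ∀ {a} → 0 < δ a → (∀ {b} → Adj G a b → δ b ≤ δ a) → ConnectedIn G (_≢ a)
    peak-not-cut {a} δa>0 peak b c b≢a c≢a =
      let _ , wb = descend _ b≢a refl
          _ , wc = descend _ c≢a refl
      in _ , wb ++ʷ reverse wc
      where
      end≢a : ∀ {u} → IsEnd u x → u ≢ a
      end≢a u∈x refl = <⇒≢ δa>0 (sym (end⇒δ≡0 u∈x))

      end-to-end₁ : ∀ {u} → IsEnd u x → ∃[ m ] WalkIn G (_≢ a) u (end₁ x) m
      end-to-end₁ (inj₁ refl) = 0 , here (end≢a (inj₁ refl))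
      end-to-end₁ (inj₂ refl) with ends-joined x
      ... | inj₁ eq = 0 , subst (λ v → WalkIn G (_≢ a) v (end₁ x) 0) eq (here (end≢a (inj₁ refl)))
      ... | inj₂ e = 1 , step (end≢a (inj₂ refl)) (adj-sym e) (here (end≢a (inj₁ refl)))

      descend : ∀ k {u} → u ≢ a → δ u ≡ k → ∃[ m ] WalkIn G (_≢ a) u (end₁ x) m
      descend zero _ δu≡0 = end-to-end₁ (δ≡0⇒end δu≡0)
      descend (suc k) u≢a δu≡1+k with δ-pred δu≡1+k
      ... | v , e , δv≡k with v ≟ᶠ a
      ... | yes refl = ⊥-elim (1+n≰n (subst₂ _≤_ δu≡1+k δv≡k (peak (adj-sym e))))
      ... | no v≢a = let m , w = descend k v≢a δv≡k in suc m , step u≢a e w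

    module _ {C : Subset n} (cuts : ∀ {v} → v ∈ C → IsCutVertex G v) where

      noncut-or-farther : ∀ {u} → 0 < δ u → u ∉ C ⊎ ∃[ b ] Adj G u b × δ u < δ b
      noncut-or-farther {u} δu>0 with u ∈? C
      ... | no u∉C = inj₁ u∉C
      ... | yes u∈C with any? (λ b → adj? u b ×-dec δ u <? δ b)
      ...   | yes farther = inj₂ farther
      ...   | no ¬farther = ⊥-elim (cuts u∈C (peak-not-cut δu>0 λ e → ≮⇒≥ λ lt → ¬farther (_ , e , lt)))

      climb : ∀ f {u} → maximum δ ≤ δ u + f → 0 < δ u → ∃[ w ] w ∉ C × δ u + dist u w ≤ δ w
      climb f {u} bound δu>0 with noncut-or-farther δu>0
      ... | inj₁ u∉C = u , u∉C , ≤-reflexive (trans (cong (δ u +_) (dist-refl u)) (+-identityʳ _))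
      climb zero {u} bound _ | inj₂ (b , _ , δu<δb) =
        ⊥-elim (<⇒≱ δu<δb (≤-trans (≤-maximum δ b) (subst (maximum δ ≤_) (+-identityʳ _) bound)))
      climb (suc f) {u} bound δu>0 | inj₂ (b , e , δu<δb) =
        let bound′ = ≤-trans bound (≤-trans (≤-reflexive (+-suc (δ u) f)) (+-monoˡ-≤ f δu<δb))
            w , w∉C , h = climb f bound′ (<-trans δu>0 δu<δb)
        in w , w∉C , (begin
          δ u + dist u w         ≤⟨ +-monoʳ-≤ (δ u) (dist-adjˡ e) ⟩
          δ u + suc (dist b w)   ≡⟨ +-suc (δ u) (dist b w) ⟩
          suc (δ u) + dist b w   ≤⟨ +-monoˡ-≤ (dist b w) δu<δb ⟩
          δ b + dist b w         ≤⟨ h ⟩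
          δ w                    ∎)
        where open ≤-Reasoning

  module _ {C : Subset n} (cuts : ∀ {v} → v ∈ C → IsCutVertex G v) where

    noncut-separates : ∀ x y {a} → IsEnd a y → ¬ IsEnd a x
                     → ∃[ w ] w ∈ ∁ C × elem-dist y w < elem-dist x w
    noncut-separates x y {a} a∈y a∉x =
      let open Climb x
          w , w∉C , h = climb cuts (maximum δ) (m≤n+m _ _) (¬end⇒δ>0 a∉x)
      in w , x∉p⇒x∈∁p w∉C , (begin-strict
        elem-dist y w   ≤⟨ elem-dist≤end y w a∈y ⟩
        dist a w        <⟨ +-monoˡ-< (dist a w) (¬end⇒δ>0 a∉x) ⟩
        δ a + dist a w  ≤⟨ h ⟩
        δ w             ∎)
      where open ≤-Reasoning

    noncut-resolving : IsMixedResolving G (∁ C)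
    noncut-resolving x y x≠y with differing-end x y x≠y
    ... | inj₁ (_ , a∈y , a∉x) =
      let w , w∈ , lt = noncut-separates x y a∈y a∉x in w , w∈ , resolves-by-< x y lt
    ... | inj₂ (_ , a∈x , a∉y) =
      let w , w∈ , lt = noncut-separates y x a∈x a∉y in w , w∈ , resolves-sym (resolves-by-< y x lt)

module SimplicialVertices {n : ℕ} (G : Graph n) where
  open Walks G

  Simplicial : Fin n → Set
  Simplicial v = ∀ {x y} → Adj G v x → Adj G v y → x ≢ y → Adj G x y

  simplicial-neighbour-no-farther : ∀ {v u} → Simplicial v → Adj G v u
    → ∀ {w k j} → Walk G v w k → w ≢ v → IsDist G u w j → j ≤ k
  simplicial-neighbour-no-farther _ _ (here _) w≢v _ = ⊥-elim (w≢v refl)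
  simplicial-neighbour-no-farther {u = u} simp v~u (step {b = x} _ v~x w) _ (_ , minimal) with x ≟ᶠ u
  ... | yes refl = m≤n⇒m≤1+n (minimal _ w)
  ... | no x≢u = minimal _ (step tt (simp v~u v~x (x≢u ∘ sym)) w)

  -- No vertex other than v tells u from the edge vu.
  simplicial∈resolving : ∀ {v u W} → Simplicial v → Adj G v u → IsMixedResolving G W → v ∈ W
  simplicial∈resolving {v} {u} {W} simp v~u res = decidable-stable (v ∈? W) λ v∉W →
    let w , w∈W , i , j , du , (i₁ , j₁ , dv , du′ , j≡i₁⊓j₁) , i≢j = res (vtx u) (edg v u v~u) (λ ())
        j₁≤i₁ = simplicial-neighbour-no-farther simp v~u (proj₁ dv) (λ w≡v → v∉W (subst (_∈ W) w≡v w∈W)) du′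
    in i≢j (begin
      i         ≡⟨ isDist-unique du du′ ⟩
      j₁        ≡⟨ sym (m≥n⇒m⊓n≡n j₁≤i₁) ⟩
      i₁ ⊓ j₁   ≡⟨ sym j≡i₁⊓j₁ ⟩
      j         ∎)
    where open ≡-Reasoning

module Blocks {n : ℕ} (G : Graph n) where
  open Walks G
  open SimplicialVertices G using (Simplicial)

  connectedIn-⇔ : ∀ {P Q : Fin n → Set} → (∀ {c} → P c → Q c) → (∀ {c} → Q c → P c)
                → ConnectedIn G P → ConnectedIn G Q
  connectedIn-⇔ P⇒Q Q⇒P conn a b qa qb = let k , w = conn a b (Q⇒P qa) (Q⇒P qb) in k , mapʷ P⇒Q w

  record TwoConnected (S : Subset n) : Set where
    field
      connected     : ConnectedIn G (_∈ S)
      no-cut-vertex : NoCutVertexIn G (_∈ S)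
      nontrivial    : ∃[ a ] ∃[ b ] a ∈ S × b ∈ S × a ≢ b

  module _ {S : Subset n} (S-2c : TwoConnected S) where
    open TwoConnected S-2c

    some-member : ∃[ a ] a ∈ S
    some-member = let a , _ , a∈S , _ = nontrivial in a , a∈S

    other-member : ∀ z → ∃[ h ] h ∈ S × h ≢ z
    other-member z with nontrivial
    ... | a , b , a∈S , b∈S , a≢b with a ≟ᶠ z
    ... | yes refl = b , b∈S , a≢b ∘ sym
    ... | no a≢z = a , a∈S , a≢z

    minus-connected : ∀ z → ConnectedIn G (λ c → c ∈ S × c ≢ z)
    minus-connected z with z ∈? S
    ... | yes z∈S = no-cut-vertex z z∈S
    ... | no z∉S = connectedIn-⇔ (λ c∈S → c∈S , λ { refl → z∉S c∈S }) proj₁ connected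

  edge-twoConnected : ∀ {a b} → Adj G a b → TwoConnected (⁅ a ⁆ ∪ ⁅ b ⁆)
  edge-twoConnected {a} {b} a~b = record
    { connected     = λ c d c∈ d∈ → link c∈ d∈ c∈ d∈
    ; no-cut-vertex = λ _ _ c d c∉ d∉ → link (proj₁ c∉) (proj₁ d∉) c∉ d∉
    ; nontrivial    = a , b , ∈edge (inj₁ refl) , ∈edge (inj₂ refl) , adj⇒≢ a~b
    }
    where
    ∈edge : ∀ {c} → c ≡ a ⊎ c ≡ b → c ∈ ⁅ a ⁆ ∪ ⁅ b ⁆
    ∈edge (inj₁ refl) = x∈p∪q⁺ (inj₁ (x∈⁅x⁆ a))
    ∈edge (inj₂ refl) = x∈p∪q⁺ (inj₂ (x∈⁅x⁆ b))

    link : ∀ {P : Fin n → Set} {c d} → c ∈ ⁅ a ⁆ ∪ ⁅ b ⁆ → d ∈ ⁅ a ⁆ ∪ ⁅ b ⁆ → P c → P d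
         → ∃[ k ] WalkIn G P c d k
    link c∈ d∈ with Sum.map (x∈⁅y⁆⇒x≡y a) (x∈⁅y⁆⇒x≡y b) (x∈p∪q⁻ ⁅ a ⁆ ⁅ b ⁆ c∈)
                  | Sum.map (x∈⁅y⁆⇒x≡y a) (x∈⁅y⁆⇒x≡y b) (x∈p∪q⁻ ⁅ a ⁆ ⁅ b ⁆ d∈)
    ... | inj₁ refl | inj₁ refl = λ pc _ → 0 , here pc
    ... | inj₁ refl | inj₂ refl = λ pc pd → 1 , step pc a~b (here pd)
    ... | inj₂ refl | inj₁ refl = λ pc pd → 1 , step pc (adj-sym a~b) (here pd)
    ... | inj₂ refl | inj₂ refl = λ pc _ → 0 , here pc

  module Ear {S : Subset n} (S-2c : TwoConnected S) {s y t : Fin n} (s∈S : s ∈ S) (s~y : Adj G s y)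
             (t∈S : t ∈ S) {D : Fin n → Set} (avoids-s : ∀ {c} → D c → c ≢ s)
             {k : ℕ} (Q : WalkIn G D y t k) (Q-path : NoRepeat Q) where
    open TwoConnected S-2c

    InEar : Fin n → Set
    InEar c = c ∈ S ⊎ On Q c

    S′ : Subset n
    S′ = S ∪ ⟦ on? Q ⟧

    ∈S′⁺ : ∀ {c} → InEar c → c ∈ S′
    ∈S′⁺ = x∈p∪q⁺ ∘ Sum.map₂ (∈⟦⟧⁺ (on? Q))

    ∈S′⁻ : ∀ {c} → c ∈ S′ → InEar c
    ∈S′⁻ = Sum.map₂ (∈⟦⟧⁻ (on? Q)) ∘ x∈p∪q⁻ S _

    into-S : ∀ {c} → InEar c → ∃[ s′ ] s′ ∈ S × ∃[ m ] WalkIn G InEar c s′ m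
    into-S (inj₁ c∈S) = _ , c∈S , 0 , here (inj₁ c∈S)
    into-S (inj₂ c∈Q) = let m , _ , w = suffix Q c∈Q in t , t∈S , m , mapʷ inj₂ w

    -- Off Q, follow Q to t; if z lies on Q, one of its two ends still leads into S: via t or via y ~ s.
    into-S-avoiding : ∀ z {c} → InEar c → c ≢ z
                    → ∃[ s′ ] s′ ∈ S × s′ ≢ z × ∃[ m ] WalkIn G (λ v → InEar v × v ≢ z) c s′ m
    into-S-avoiding z (inj₁ c∈S) c≢z = _ , c∈S , c≢z , 0 , here (inj₁ c∈S , c≢z)
    into-S-avoiding z (inj₂ c∈Q) c≢z with on? Q z
    ... | no z∉Q = let m , _ , w = suffix Q c∈Q in
        t , t∈S , (λ { refl → z∉Q (on-last Q) }) , m , mapʷ (λ v∈Q → inj₂ v∈Q , λ { refl → z∉Q v∈Q }) w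
    ... | yes z∈Q with reach-an-end Q Q-path z∈Q c∈Q c≢z
    ...   | inj₁ (m , w) = t , t∈S , proj₂ (last-in w) , m , mapʷ (map₁ inj₂) w
    ...   | inj₂ (m , w) = s , s∈S , s≢z , suc m , snoc (mapʷ (map₁ inj₂) w) (adj-sym s~y) (inj₁ s∈S , s≢z)
      where
      s≢z : s ≢ z
      s≢z s≡z = avoids-s (on-inside Q z∈Q) (sym s≡z)

    ear-connected : ConnectedIn G InEar
    ear-connected a b a∈ b∈ =
      let sa , sa∈S , _ , wa = into-S a∈
          sb , sb∈S , _ , wb = into-S b∈
          _ , wm = connected sa sb sa∈S sb∈S
      in _ , wa ++ʷ mapʷ inj₁ wm ++ʷ reverse wb

    ear-no-cut-vertex : NoCutVertexIn G InEar
    ear-no-cut-vertex z _ a b (a∈ , a≢z) (b∈ , b≢z) =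
      let sa , sa∈S , sa≢z , _ , wa = into-S-avoiding z a∈ a≢z
          sb , sb∈S , sb≢z , _ , wb = into-S-avoiding z b∈ b≢z
          _ , wm = minus-connected S-2c z sa sb (sa∈S , sa≢z) (sb∈S , sb≢z)
      in _ , wa ++ʷ mapʷ (map₁ inj₁) wm ++ʷ reverse wb

    ear-twoConnected : TwoConnected S′
    ear-twoConnected = record
      { connected     = connectedIn-⇔ ∈S′⁺ ∈S′⁻ ear-connected
      ; no-cut-vertex = λ z z∈ → connectedIn-⇔ (map₁ ∈S′⁺) (map₁ ∈S′⁻) (ear-no-cut-vertex z (∈S′⁻ z∈))
      ; nontrivial    = let a , b , a∈S , b∈S , a≢b = nontrivial in a , b , p⊆p∪q _ a∈S , p⊆p∪q _ b∈S , a≢b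
      }

  -- Opaque for the same reason as dist: unfolding the enlarged set during unification is very costly.
  opaque
    add-ear : ∀ {S s y t} {D : Fin n → Set} {k} → TwoConnected S → s ∈ S → Adj G s y → t ∈ S
            → (∀ {c} → D c → c ≢ s) → WalkIn G D y t k
            → ∃[ S′ ] TwoConnected S′ × S ⊆ S′ × y ∈ S′ × (∀ {c} → c ∈ S′ → c ∈ S ⊎ D c)
    add-ear S-2c s∈S s~y t∈S avoids-s W with to-path W
    ... | _ , Q , Q-path =
      S′ , ear-twoConnected , p⊆p∪q _ , ∈S′⁺ (inj₂ (on-head Q)) , Sum.map₂ (on-inside Q) ∘ ∈S′⁻
      where open Ear S-2c s∈S s~y t∈S avoids-s Q Q-path

  crossing-edge : ∀ {P : Fin n → Set} {S b c k} → WalkIn G P b c k → b ∉ S → c ∈ S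
                → ∃[ y ] ∃[ s ] P y × y ∉ S × s ∈ S × Adj G y s
  crossing-edge (here _) b∉S b∈S = ⊥-elim (b∉S b∈S)
  crossing-edge {S = S} (step {b = b′} pb e w) b∉S c∈S with b′ ∈? S
  ... | yes b′∈S = _ , b′ , pb , b∉S , b′∈S , e
  ... | no b′∉S = crossing-edge w b′∉S c∈S

  module _ {T : Fin n → Set} (T-conn : ConnectedIn G T) (T-no-cut : NoCutVertexIn G T) where

    grow-within : ∀ f {S a} → n < f + ∣ S ∣ → TwoConnected S → (∀ {c} → c ∈ S → T c) → T a
                → ∃[ S′ ] TwoConnected S′ × S ⊆ S′ × a ∈ S′
    grow-within zero {S} bound _ _ _ = ⊥-elim (<⇒≱ bound (∣p∣≤n S))
    grow-within (suc f) {S} {a} bound S-2c S⊆T a∈T with a ∈? S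
    ... | yes a∈S = S , S-2c , id , a∈S
    ... | no a∉S =
      let s₀ , s₀∈S = some-member S-2c
          y , s , y∈T , y∉S , s∈S , y~s = crossing-edge (proj₂ (T-conn a s₀ a∈T (S⊆T s₀∈S))) a∉S s₀∈S
          s₂ , s₂∈S , s₂≢s = other-member S-2c s
          _ , W = T-no-cut s (S⊆T s∈S) y s₂ (y∈T , adj⇒≢ y~s) (S⊆T s₂∈S , s₂≢s)
          S′ , S′-2c , S⊆S′ , y∈S′ , S′⊆S∪W = add-ear S-2c s∈S (adj-sym y~s) s₂∈S proj₂ W
          bound′ = ≤-trans bound (≤-trans (≤-reflexive (sym (+-suc f _)))
                     (+-monoʳ-≤ f (p⊂q⇒∣p∣<∣q∣ (S⊆S′ , y , y∈S′ , y∉S))))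
          S″ , S″-2c , S′⊆S″ , a∈S″ =
            grow-within f bound′ S′-2c (Sum.[ S⊆T , proj₁ ]′ ∘ S′⊆S∪W) a∈T
      in S″ , S″-2c , S′⊆S″ ∘ S⊆S′ , a∈S″

  block-containing : ∀ {σ} → TwoConnected σ → Σ (Fin n → Set) λ B → IsBlock G B × (∀ {c} → c ∈ σ → B c)
  block-containing {σ} σ-2c =
    InBlock , (map₂ σ⊆InBlock (some-member σ-2c) , connected , no-cut-vertex , maximal) , σ⊆InBlock
    where
    InBlock : Fin n → Set
    InBlock c = ∃[ T ] TwoConnected T × σ ⊆ T × c ∈ T

    into-block : ∀ {T c} → TwoConnected T → σ ⊆ T → c ∈ T → InBlock c
    into-block T-2c σ⊆T c∈T = _ , T-2c , σ⊆T , c∈T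

    σ⊆InBlock : ∀ {c} → c ∈ σ → InBlock c
    σ⊆InBlock = into-block σ-2c id

    connected : ConnectedIn G InBlock
    connected a b (_ , Ta-2c , σ⊆Ta , a∈Ta) (_ , Tb-2c , σ⊆Tb , b∈Tb) =
      let h , h∈σ = some-member σ-2c
          _ , wa = TwoConnected.connected Ta-2c a h a∈Ta (σ⊆Ta h∈σ)
          _ , wb = TwoConnected.connected Tb-2c b h b∈Tb (σ⊆Tb h∈σ)
      in _ , mapʷ (into-block Ta-2c σ⊆Ta) wa ++ʷ reverse (mapʷ (into-block Tb-2c σ⊆Tb) wb)

    no-cut-vertex : NoCutVertexIn G InBlock
    no-cut-vertex v _ a b ((_ , Ta-2c , σ⊆Ta , a∈Ta) , a≢v) ((_ , Tb-2c , σ⊆Tb , b∈Tb) , b≢v) =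
      let h′ , h′∈σ , h′≢v = other-member σ-2c v
          _ , wa = minus-connected Ta-2c v a h′ (a∈Ta , a≢v) (σ⊆Ta h′∈σ , h′≢v)
          _ , wb = minus-connected Tb-2c v b h′ (b∈Tb , b≢v) (σ⊆Tb h′∈σ , h′≢v)
      in _ , mapʷ (map₁ (into-block Ta-2c σ⊆Ta)) wa ++ʷ reverse (mapʷ (map₁ (into-block Tb-2c σ⊆Tb)) wb)

    maximal : ∀ T → (∀ a → InBlock a → T a) → ConnectedIn G T → NoCutVertexIn G T → ∀ a → T a → InBlock a
    maximal T InBlock⊆T T-conn T-no-cut a =
      grow-within T-conn T-no-cut (suc n) (s≤s (m≤m+n n _)) σ-2c (λ {c} c∈σ → InBlock⊆T c (σ⊆InBlock c∈σ))

  noncut⇒simplicial : ∀ {v} → IsBlockGraph G → ConnectedIn G (_≢ v) → Simplicial v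
  noncut⇒simplicial bg G-v-conn {x} {y} v~x v~y x≢y =
    let _ , W = G-v-conn y x (adj⇒≢ v~y ∘ sym) (adj⇒≢ v~x ∘ sym)
        v∈vx = x∈p∪q⁺ (inj₁ (x∈⁅x⁆ _))
        x∈vx = x∈p∪q⁺ (inj₂ (x∈⁅x⁆ x))
        S , S-2c , vx⊆S , y∈S , _ = add-ear (edge-twoConnected v~x) v∈vx v~y x∈vx id W
        B , B-block , S⊆B = block-containing S-2c
    in bg B B-block x y (S⊆B (vx⊆S x∈vx)) (S⊆B y∈S) x≢y

module _ {n : ℕ} (G : Graph n) where
  open Walks G
  open SimplicialVertices G
  open Blocks G

  has-neighbour : 2 ≤ n → Connected G → ∀ v → ∃[ u ] Adj G v u
  has-neighbour (s≤s (s≤s z≤n)) conn v = first-step (punchInᵢ≢i v zero) (proj₂ (conn v _ tt tt))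
    where
    first-step : ∀ {o k} → o ≢ v → Walk G v o k → ∃[ u ] Adj G v u
    first-step o≢v (here _) = ⊥-elim (o≢v refl)
    first-step _ (step _ v~u _) = _ , v~u

  noncut∈resolving : IsBlockGraph G → 2 ≤ n → Connected G → ∀ {v W}
                   → ¬ IsCutVertex G v → IsMixedResolving G W → v ∈ W
  noncut∈resolving bg 2≤n conn {v} {W} v-noncut W-res = decidable-stable (v ∈? W) λ v∉W →
    v-noncut λ G-v-conn →
      v∉W (simplicial∈resolving (noncut⇒simplicial bg G-v-conn) (proj₂ (has-neighbour 2≤n conn v)) W-res)

mainTheorem8 : ∀ {n} (G : Graph n) → 2 ≤ n → Connected G → IsBlockGraph G
    → (C : Subset n) → (∀ v → (v ∈ C) ⇔ IsCutVertex G v)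
    → MixedMetricDimIs G (n ∸ ∣ C ∣)
mainTheorem8 G 2≤n conn bg C C≡cuts =
  (∁ C , Resolving.noncut-resolving G conn (λ {v} → Equivalence.to (C≡cuts v)) , ∣∁p∣≡n∸∣p∣ C) ,
  λ W W-res → subst (_≤ ∣ W ∣) (∣∁p∣≡n∸∣p∣ C) (p⊆q⇒∣p∣≤∣q∣ λ {v} v∈∁C →
    noncut∈resolving G bg 2≤n conn (x∈∁p⇒x∉p v∈∁C ∘ Equivalence.from (C≡cuts v)) W-res)
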